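{- Let $S\in\Sigma^n$, let $\ell^*$ be a natural number and let $h\ge 2$. Let $m_1<m_2<\dots<m_h$ be indices of $S$ that are consecutive midpoints of $\ell^*$-palindromes (i.e. $\ell(m_j)\ge\ell^*$ for all $j$ and no index strictly between $m_1$ and $m_h$ other than $m_2,\dots,m_{h-1}$ is the midpoint of an $\ell^*$-palindrome). If $m_h-m_1\le\ell^*$, then (a) $m_1,\dots,m_h$ are equally spaced: $m_{k+1}-m_k=m_2-m_1$ for all $k\in\{1,\dots,h-1\}$; (b) with $w=S[m_1+1,m_2]$ and $w^R$ its reverse, $$S[m_1+1,m_h]=\begin{cases}(ww^R)^{\frac{h-1}{2}} & h\text{ odd},\\ (ww^R)^{\frac{h-2}{2}}\,w & h\text{ even}.\end{cases}$$
   Context: $S[i,j]$ denotes $S[i]S[i+1]\cdots S[j]$. Palindromes are considered in their even form: $S$ contains a palindrome of length $\ell$ with midpoint $m$ if $S[m-i+1]=S[m+i]$ for all $i\in\{1,\dots,\ell\}$ (indices within $\{1,\dots,n\}$); $\ell(m)$ is the maximal such $\ell$. The palindrome centered at $m$ is an $\ell^*$-palindrome if $\ell(m)\ge\ell^*$. -}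

module Defs where

open import Data.Nat using (ℕ; zero; suc; _+_; _∸_; _≤_; _<_)
open import Data.List using (List; []; _∷_; _++_; take; drop; reverse; concat; replicate)
open import Data.Vec using (Vec; toList)
open import Data.Maybe using (Maybe; just; nothing)
open import Data.Product using (Σ; ∃; _×_)
open import Relation.Binary.PropositionalEquality using (_≡_)

nth : {A : Set} → List A → ℕ → Maybe A
nth []       _       = nothing
nth (x ∷ xs) zero    = just x
nth (x ∷ xs) (suc k) = nth xs k

-- S[k] with the paper's 1-indexing (k ∈ {1,…,n})
charAt : {A : Set} {n : ℕ} → Vec A n → ℕ → Maybe A
charAt S k = nth (toList S) (k ∸ 1)

-- S[i,j] = S[i] S[i+1] ⋯ S[j]  (1-indexed, i ≥ 1, j ≤ n)
slice : {A : Set} {n : ℕ} → Vec A n → ℕ → ℕ → List A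
slice S i j = take (suc j ∸ i) (drop (i ∸ 1) (toList S))

-- S contains a (even) palindrome of length ℓ with midpoint m:
-- for all i ∈ {1,…,ℓ}, the indices m-i+1 and m+i lie in {1,…,n}
-- and S[m-i+1] = S[m+i].
HasPal : {A : Set} {n : ℕ} → Vec A n → ℕ → ℕ → Set
HasPal {n = n} S m ℓ =
  ∀ i → 1 ≤ i → i ≤ ℓ →
    (1 ≤ suc m ∸ i) × (i ≤ m) × (m + i ≤ n) × (charAt S (suc m ∸ i) ≡ charAt S (m + i))

-- ℓ(m) ≥ ℓ*, where ℓ(m) is the maximal palindrome length at m:
-- some palindrome of length ≥ ℓ* is centred at m.
IsPalMid : {A : Set} {n : ℕ} → Vec A n → ℕ → ℕ → Set
IsPalMid S ℓ* m = ∃ λ ℓ → ℓ* ≤ ℓ × HasPal S m ℓ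

pow : {A : Set} → List A → ℕ → List A
pow u k = concat (replicate k u)

-- If b and c are centres of ℓ-palindromes with c − b ≤ ℓ, composing the reflections in b, c, b
-- shows that the text is also symmetric about 2b − c, on every window that a third centre a on
-- the other side of b covers. Hence among three consecutive ℓ*-centres a < b < c within distance
-- ℓ* the gaps b − a and c − b are equal: otherwise reflecting the outer centre farther from b
-- across b yields an ℓ*-centre strictly inside the shorter gap. With all gaps equal to d, the
-- palindrome centred at m_{k+1} maps the block S[m_k + 1, m_{k+1}] onto the reverse of the next
-- block, so the blocks alternate w, wᴿ, w, wᴿ, ….
module Submission where

open import Data.Nat using (ℕ; zero; suc; _+_; _∸_; _*_; _≤_; _<_; z≤n; s≤s; s≤s⁻¹; _≤?_)
open import Data.Nat.Properties
open import Data.Nat.Tactic.RingSolver using (solve)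
open import Data.List using (List; []; _∷_; _++_; take; drop; reverse; fromMaybe)
open import Data.List.Properties using (reverse-++; reverse-involutive; ++-assoc; ++-identityʳ; take-[]; drop-drop)
open import Data.Maybe using (Maybe; just; nothing)
open import Data.Vec using (Vec; toList)
open import Data.Product using (∃; ∃-syntax; _,_; _×_; proj₁; proj₂)
open import Data.Sum using (inj₁; inj₂)
open import Relation.Nullary using (yes; no; ¬_; contradiction)
open import Relation.Binary using (tri<; tri≈; tri>)
open import Relation.Binary.PropositionalEquality
open import Defs

≤-by : ∀ {m n} k → m + k ≡ n → m ≤ n
≤-by {m} k refl = m≤m+n m k

-- Symmetry of f about m + ½ within radius ℓ: mirror positions are characterised by
-- x + y = 2m + 1, and the window m + 1 − ℓ … m + ℓ by the upper bounds on x and y alone.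
record Palindromic {B : Set} (f : ℕ → B) (m ℓ : ℕ) : Set where
  field
    mirror : ∀ x y → x + y ≡ suc (m + m) → x ≤ m + ℓ → y ≤ m + ℓ → f x ≡ f y

open Palindromic

NoPalindromeBetween : {B : Set} → (ℕ → B) → ℕ → ℕ → ℕ → Set
NoPalindromeBetween f ℓ a b = ∀ q → a < q → q < b → ¬ Palindromic f q ℓ

module _ {B : Set} {f : ℕ → B} where

  private
    at : ∀ {m m′ ℓ} → Palindromic f m ℓ → m ≡ m′ → Palindromic f m′ ℓ
    at {ℓ = ℓ} P eq = subst (λ m → Palindromic f m ℓ) eq P

  module _ {m ℓ : ℕ} (left : ∀ x j → x + j ≡ m → j < ℓ → f x ≡ f (m + suc j)) where

    private
      mirror-left : ∀ x y → x + y ≡ suc (m + m) → y ≤ m + ℓ → x ≤ m → f x ≡ f y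
      mirror-left x y xy y≤ x≤m with m≤n⇒∃[o]m+o≡n x≤m
      ... | j , xj = trans (left x j xj jℓ) (cong f (sym y≡))
        where
        y≡ : y ≡ m + suc j
        y≡ = +-cancelˡ-≡ x y (m + suc j) (begin
          x + y            ≡⟨ xy ⟩
          suc (m + m)      ≡⟨ cong (λ k → suc (k + m)) (sym xj) ⟩
          suc (x + j + m)  ≡⟨ solve (x ∷ j ∷ m ∷ []) ⟩
          x + (m + suc j)  ∎)
          where open ≡-Reasoning
        jℓ : j < ℓ
        jℓ = +-cancelˡ-≤ m (suc j) ℓ (subst (_≤ m + ℓ) y≡ y≤)

    palindromic-from-left : Palindromic f m ℓ
    palindromic-from-left .mirror x y xy x≤ y≤ with x ≤? m | y ≤? m
    ... | yes x≤m | _       = mirror-left x y xy y≤ x≤m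
    ... | no _    | yes y≤m = sym (mirror-left y x (trans (+-comm y x) xy) x≤ y≤m)
    ... | no x≰m  | no y≰m  = contradiction (+-cancelˡ-≤ m (suc m) m (s≤s⁻¹ too-big)) 1+n≰n
      where
      too-big : suc m + suc m ≤ suc (m + m)
      too-big = subst (suc m + suc m ≤_) xy (+-mono-≤ (≰⇒> x≰m) (≰⇒> y≰m))

  palindromic-period : ∀ {u ℓ} p → Palindromic f u ℓ → Palindromic f (u + p) ℓ →
    ∀ y z → y + z ≡ suc (u + u) → y + p ≤ u + ℓ → z ≤ u + ℓ → f y ≡ f (y + 2 * p)
  palindromic-period {u} {ℓ} p Pu Pv y z yz yp z≤ =
    trans (mirror Pu y z yz (m+n≤o⇒m≤o y yp) z≤) (mirror Pv z (y + 2 * p) zy z≤′ yp′)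
    where
    zy : z + (y + 2 * p) ≡ suc (u + p + (u + p))
    zy = let open ≡-Reasoning in begin
      z + (y + 2 * p)        ≡⟨ solve (z ∷ y ∷ p ∷ []) ⟩
      (y + z) + 2 * p        ≡⟨ cong (_+ 2 * p) yz ⟩
      suc (u + u) + 2 * p    ≡⟨ solve (u ∷ p ∷ []) ⟩
      suc (u + p + (u + p))  ∎
    z≤′ : z ≤ u + p + ℓ
    z≤′ = ≤-trans z≤ (≤-by p (solve (u ∷ ℓ ∷ p ∷ [])))
    yp′ : y + 2 * p ≤ u + p + ℓ
    yp′ = let open ≤-Reasoning in begin
      y + 2 * p  ≡⟨ solve (y ∷ p ∷ []) ⟩
      y + p + p  ≤⟨ +-monoˡ-≤ p yp ⟩
      u + ℓ + p  ≡⟨ solve (u ∷ ℓ ∷ p ∷ []) ⟩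
      u + p + ℓ  ∎

  -- For reflectˡ the new axis 2b − c is that of σ_b σ_c σ_b. A pair close to b follows σ_b and
  -- then the period 2(c − b); a pair whose left end lies outside the window of b is sent through
  -- σ_a and the periods 2(c − b) and 2(b − a) instead. reflectʳ (axis 2b − a) is the mirror image.
  -- All positions are sums of the variables vs, so every side condition is a ring identity.
  private

    reflectˡ-near : ∀ {q e ℓ} → Palindromic f (q + e) ℓ → Palindromic f (q + e + e) ℓ →
      ∀ x j → x + j ≡ q → suc j + e ≤ ℓ → f x ≡ f (q + suc j)
    reflectˡ-near {e = e} Pb Pc x j refl je with m≤n⇒∃[o]m+o≡n je
    ... | k , refl = begin
      f x
        ≡⟨ mirror Pb x (x + j + e + e + suc j) (solve vs)
             (≤-by (j + e + (suc j + e + k)) (solve vs)) (≤-by k (solve vs)) ⟩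
      f (x + j + e + e + suc j)
        ≡⟨ cong f (solve vs) ⟩
      f (x + j + suc j + 2 * e)
        ≡⟨ sym (palindromic-period e Pb Pc (x + j + suc j) (x + e + e) (solve vs)
             (≤-by (e + k) (solve vs)) (≤-by (j + suc j + k) (solve vs))) ⟩
      f (x + j + suc j) ∎
      where
      open ≡-Reasoning
      vs = x ∷ j ∷ e ∷ k ∷ []

    reflectˡ-far : ∀ {a g e s} x t → let ℓ = g + e + e + s in
      Palindromic f a ℓ → Palindromic f (a + g + e) ℓ → Palindromic f (a + g + e + e) ℓ →
      x + (g + e + s + t) ≡ a + g → suc (g + e + s + t) ≤ ℓ → f x ≡ f (a + g + suc (g + e + s + t))
    reflectˡ-far {a} {g} {e} {s} x t Pa Pb Pc xq jℓ with e≡ | a≡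
      where
      e≡ : ∃[ r ] suc t + r ≡ e
      e≡ = m≤n⇒∃[o]m+o≡n (+-cancelˡ-≤ (g + e + s) (suc t) e (begin
        g + e + s + suc t    ≡⟨ solve (g ∷ e ∷ s ∷ t ∷ []) ⟩
        suc (g + e + s + t)  ≤⟨ jℓ ⟩
        g + e + e + s        ≡⟨ solve (g ∷ e ∷ s ∷ []) ⟩
        g + e + s + e        ∎))
        where open ≤-Reasoning
      a≡ : x + e + s + t ≡ a
      a≡ = +-cancelʳ-≡ g _ _ (begin
        x + e + s + t + g    ≡⟨ solve (x ∷ g ∷ e ∷ s ∷ t ∷ []) ⟩
        x + (g + e + s + t)  ≡⟨ xq ⟩
        a + g                ∎)
        where open ≡-Reasoning
    ... | r , refl | refl =
      let ℓ = g + e + e + s ; z = suc (a + e + s + t) ; w = suc (x + s + s + t + t) in begin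
      f x
        ≡⟨ mirror Pa x z (solve vs) (≤-by (e + s + t + ℓ) (solve vs)) (≤-by (g + r) (solve vs)) ⟩
      f z
        ≡⟨ cong f (solve vs) ⟩
      f (w + 2 * e)
        ≡⟨ sym (palindromic-period e Pb Pc w (x + e + e + e + e + g + g) (solve vs)
             (≤-by (e + e + r + g + g) (solve vs)) (≤-by (s + s + t) (solve vs))) ⟩
      f w
        ≡⟨ palindromic-period (g + e) Pa (at Pb (+-assoc a g e)) w (x + e + e) (solve vs)
             (≤-by (e + r) (solve vs)) (≤-by (e + s + s + t + g) (solve vs)) ⟩
      f (w + 2 * (g + e))
        ≡⟨ cong f (solve vs) ⟩
      f (a + g + suc (g + e + s + t)) ∎
      where
      open ≡-Reasoning
      vs = x ∷ g ∷ s ∷ t ∷ r ∷ []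

    reflectʳ-near : ∀ {a d ℓ} → Palindromic f a ℓ → Palindromic f (a + d) ℓ →
      ∀ x j → x + j ≡ a + d + d → suc j + d ≤ ℓ → j ≤ a → f x ≡ f (a + d + d + suc j)
    reflectʳ-near {d = d} Pa Pb x j xq jd ja with m≤n⇒∃[o]m+o≡n jd | m≤n⇒∃[o]m+o≡n ja
    ... | k , refl | w , refl with x≡
      where
      x≡ : x ≡ w + d + d
      x≡ = +-cancelʳ-≡ j _ _ (trans xq (solve (j ∷ w ∷ d ∷ [])))
    ... | refl = begin
      f (w + d + d)
        ≡⟨ cong f (solve vs) ⟩
      f (w + 2 * d)
        ≡⟨ sym (palindromic-period d Pa Pb w (w + j + suc j) (solve vs)
             (≤-by (j + suc j + k) (solve vs)) (≤-by (d + k) (solve vs))) ⟩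
      f w
        ≡⟨ mirror Pb w (j + w + d + d + suc j) (solve vs)
             (≤-by (j + d + suc j + d + k) (solve vs)) (≤-by k (solve vs)) ⟩
      f (j + w + d + d + suc j) ∎
      where
      open ≡-Reasoning
      vs = w ∷ j ∷ d ∷ k ∷ []

    reflectʳ-far : ∀ {d h s o} x t → let ℓ = d + d + h + s ; a = ℓ + o in
      Palindromic f a ℓ → Palindromic f (a + d) ℓ → Palindromic f (a + d + d + h) ℓ →
      x + (d + h + s + t) ≡ a + d + d → suc (d + h + s + t) ≤ ℓ →
      f x ≡ f (a + d + d + suc (d + h + s + t))
    reflectʳ-far {d} {h} {s} {o} x t Pa Pb Pc xq jℓ with d≡
      where
      d≡ : ∃[ r ] suc t + r ≡ d
      d≡ = m≤n⇒∃[o]m+o≡n (+-cancelˡ-≤ (d + h + s) (suc t) d (begin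
        d + h + s + suc t    ≡⟨ solve (d ∷ h ∷ s ∷ t ∷ []) ⟩
        suc (d + h + s + t)  ≤⟨ jℓ ⟩
        d + d + h + s        ≡⟨ solve (d ∷ h ∷ s ∷ []) ⟩
        d + h + s + d        ∎))
        where open ≤-Reasoning
    ... | r , refl with x≡
      where
      x≡ : x ≡ o + d + d + suc r
      x≡ = +-cancelʳ-≡ (d + h + s + t) _ _ (trans xq (solve (o ∷ h ∷ s ∷ t ∷ r ∷ [])))
    ... | refl =
      let a = d + d + h + s + o ; b = a + d
          y = a + d + d + suc (d + h + s + t) ; z = o + h + h + d + d + suc r in begin
      f x
        ≡⟨ palindromic-period (d + h) Pb (at Pc (+-assoc b d h)) x (o + d + d + d + suc t + h + h + s + s)
             (solve vs) (≤-by (d + t + h + s + s) (solve vs)) (≤-by (d + r) (solve vs)) ⟩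
      f (x + 2 * (d + h))
        ≡⟨ cong f (solve vs) ⟩
      f (z + 2 * d)
        ≡⟨ sym (palindromic-period d Pa Pb z (d + s + s + o + suc t) (solve vs)
             (≤-by (s + s + t) (solve vs)) (≤-by (d + d + r + h + h) (solve vs))) ⟩
      f z
        ≡⟨ mirror Pc z y (solve vs)
             (≤-by (d + d + d + h + s + s + t) (solve vs)) (≤-by (r + h) (solve vs)) ⟩
      f y ∎
      where
      open ≡-Reasoning
      vs = o ∷ h ∷ s ∷ t ∷ r ∷ []

  palindromic-reflectˡ : ∀ {a g e ℓ} → Palindromic f a ℓ → Palindromic f (a + g + e) ℓ →
    Palindromic f (a + g + e + e) ℓ → g + e + e ≤ ℓ → Palindromic f (a + g) ℓ
  palindromic-reflectˡ {a} {g} {e} Pa Pb Pc gℓ with m≤n⇒∃[o]m+o≡n gℓ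
  ... | s , refl = palindromic-from-left left-half
    where
    left-half : ∀ x j → x + j ≡ a + g → j < g + e + e + s → f x ≡ f (a + g + suc j)
    left-half x j xq jℓ with g + e + s ≤? j
    ... | yes far with m≤n⇒∃[o]m+o≡n far
    ...   | t , refl = reflectˡ-far {a} {g} {e} {s} x t Pa Pb Pc xq jℓ
    left-half x j xq jℓ | no near = reflectˡ-near Pb Pc x j xq (begin
      suc j + e      ≤⟨ +-monoˡ-≤ e (≰⇒> near) ⟩
      g + e + s + e  ≡⟨ solve (g ∷ e ∷ s ∷ []) ⟩
      g + e + e + s  ∎)
      where open ≤-Reasoning

  palindromic-reflectʳ : ∀ {a d h ℓ} → Palindromic f a ℓ → Palindromic f (a + d) ℓ →
    Palindromic f (a + d + d + h) ℓ → d + d + h ≤ ℓ → ℓ ≤ a → Palindromic f (a + d + d) ℓ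
  palindromic-reflectʳ {d = d} {h} Pa Pb Pc dℓ ℓa with m≤n⇒∃[o]m+o≡n dℓ | m≤n⇒∃[o]m+o≡n ℓa
  ... | s , refl | o , refl = palindromic-from-left left-half
    where
    ℓ = d + d + h + s
    left-half : ∀ x j → x + j ≡ ℓ + o + d + d → j < ℓ → f x ≡ f (ℓ + o + d + d + suc j)
    left-half x j xq jℓ with d + h + s ≤? j
    ... | yes far with m≤n⇒∃[o]m+o≡n far
    ...   | t , refl = reflectʳ-far {d} {h} {s} {o} x t Pa Pb Pc xq jℓ
    left-half x j xq jℓ | no near = reflectʳ-near Pa Pb x j xq (begin
      suc j + d      ≤⟨ +-monoˡ-≤ d (≰⇒> near) ⟩
      d + h + s + d  ≡⟨ solve (d ∷ h ∷ s ∷ []) ⟩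
      d + d + h + s  ∎) (≤-trans (<⇒≤ jℓ) (m≤m+n ℓ o))
      where open ≤-Reasoning

  palindromic-gaps-equal : ∀ {a b c u v ℓ} →
    Palindromic f a ℓ → Palindromic f b ℓ → Palindromic f c ℓ → a + u ≡ b → b + v ≡ c →
    0 < u → 0 < v → c ≤ a + ℓ → ℓ ≤ a →
    NoPalindromeBetween f ℓ a b → NoPalindromeBetween f ℓ b c → u ≡ v
  palindromic-gaps-equal {a} {u = u} {v} {ℓ} Pa Pb Pc refl refl 0<u 0<v c≤ ℓa free₁ free₂
    with <-cmp u v | +-cancelˡ-≤ a (u + v) ℓ (subst (_≤ a + ℓ) (+-assoc a u v) c≤)
  ... | tri≈ _ u≡v _ | _ = u≡v
  ... | tri< u<v _ _ | uvℓ with m≤n⇒∃[o]m+o≡n u<v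
  ...   | h , refl = contradiction
          (palindromic-reflectʳ {h = suc h} Pa Pb (at Pc (solve (a ∷ u ∷ h ∷ []))) (begin
              u + u + suc h    ≡⟨ solve (u ∷ h ∷ []) ⟩
              u + (suc u + h)  ≤⟨ uvℓ ⟩
              ℓ                ∎) ℓa)
          (free₂ _ (m<m+n (a + u) 0<u) (≤-by h (solve (a ∷ u ∷ h ∷ []))))
    where open ≤-Reasoning
  palindromic-gaps-equal {a} {u = u} {v} {ℓ} Pa Pb Pc refl refl 0<u 0<v c≤ ℓa free₁ free₂
    | tri> _ _ v<u | uvℓ with m≤n⇒∃[o]m+o≡n v<u
  ...   | g , refl = contradiction
          (palindromic-reflectˡ {g = suc g} {e = v} Pa
            (at Pb (solve (a ∷ v ∷ g ∷ []))) (at Pc (solve (a ∷ v ∷ g ∷ []))) (begin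
              suc g + v + v    ≡⟨ solve (v ∷ g ∷ []) ⟩
              suc v + g + v    ≤⟨ uvℓ ⟩
              ℓ                ∎))
          (free₁ _ (m<m+n a (s≤s z≤n)) (+-monoʳ-< a (s≤s (m<n+m g 0<v))))
    where open ≤-Reasoning

module _ {A : Set} where

  take-+ : ∀ m n (xs : List A) → take (m + n) xs ≡ take m xs ++ take n (drop m xs)
  take-+ zero    n xs       = refl
  take-+ (suc m) n []       = sym (take-[] n)
  take-+ (suc m) n (x ∷ xs) = cong (x ∷_) (take-+ m n xs)

  take-sucʳ : ∀ p (xs : List A) → take (suc p) xs ≡ take p xs ++ fromMaybe (nth xs p)
  take-sucʳ zero    []       = refl
  take-sucʳ zero    (x ∷ xs) = refl
  take-sucʳ (suc p) []       = refl
  take-sucʳ (suc p) (x ∷ xs) = cong (x ∷_) (take-sucʳ p xs)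

  take-suc-drop : ∀ p k (xs : List A) →
    take (suc p) (drop k xs) ≡ fromMaybe (nth xs k) ++ take p (drop (suc k) xs)
  take-suc-drop p zero    []       = sym (take-[] p)
  take-suc-drop p zero    (x ∷ xs) = refl
  take-suc-drop p (suc k) []       = sym (take-[] p)
  take-suc-drop p (suc k) (x ∷ xs) = take-suc-drop p k xs

  nth-drop : ∀ m p (xs : List A) → nth (drop m xs) p ≡ nth xs (m + p)
  nth-drop zero    p xs       = refl
  nth-drop (suc m) p []       = refl
  nth-drop (suc m) p (x ∷ xs) = nth-drop m p xs

  reverse-fromMaybe : (x : Maybe A) → reverse (fromMaybe x) ≡ fromMaybe x
  reverse-fromMaybe nothing  = refl
  reverse-fromMaybe (just x) = refl

  pow-sucʳ : ∀ (u : List A) k → pow u (suc k) ≡ pow u k ++ u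
  pow-sucʳ u zero    = ++-identityʳ u
  pow-sucʳ u (suc k) = trans (cong (u ++_) (pow-sucʳ u k)) (sym (++-assoc u (pow u k) u))

module _ {A : Set} (xs : List A) (d : ℕ) where

  block : ℕ → List A
  block t = take d (drop (t * d) xs)

  take-*-suc : ∀ t → take (suc t * d) xs ≡ take (t * d) xs ++ block t
  take-*-suc t = trans (cong (λ m → take m xs) (+-comm d (t * d))) (take-+ (t * d) d xs)

  module _ {B : ℕ} (mirrored : ∀ t → suc t < B → block (suc t) ≡ reverse (block t)) where

    block-even : ∀ k → k + k < B → block (k + k) ≡ block 0
    block-even zero    _   = refl
    block-even (suc k) lt rewrite +-suc k k = begin
      block (suc (suc (k + k)))          ≡⟨ mirrored (suc (k + k)) lt ⟩
      reverse (block (suc (k + k)))      ≡⟨ cong reverse (mirrored (k + k) (<⇒≤ lt)) ⟩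
      reverse (reverse (block (k + k)))  ≡⟨ reverse-involutive (block (k + k)) ⟩
      block (k + k)                      ≡⟨ block-even k (<⇒≤ (<⇒≤ lt)) ⟩
      block 0                            ∎
      where open ≡-Reasoning

    block-odd : ∀ k → suc (k + k) < B → block (suc (k + k)) ≡ reverse (block 0)
    block-odd k k<B = trans (mirrored (k + k) k<B) (cong reverse (block-even k (<⇒≤ k<B)))

    take-even : ∀ k → k + k ≤ B → take ((k + k) * d) xs ≡ pow (block 0 ++ reverse (block 0)) k
    take-even zero    _   = refl
    take-even (suc k) le rewrite +-suc k k = begin
      take (suc (suc (k + k)) * d) xs
        ≡⟨ take-*-suc (suc (k + k)) ⟩
      take (suc (k + k) * d) xs ++ block (suc (k + k))
        ≡⟨ cong₂ _++_ (take-*-suc (k + k)) (block-odd k le) ⟩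
      (take ((k + k) * d) xs ++ block (k + k)) ++ reverse (block 0)
        ≡⟨ cong₂ (λ p b → (p ++ b) ++ reverse (block 0))
             (take-even k (<⇒≤ (<⇒≤ le))) (block-even k (<⇒≤ le)) ⟩
      (pow u k ++ block 0) ++ reverse (block 0)
        ≡⟨ ++-assoc (pow u k) (block 0) (reverse (block 0)) ⟩
      pow u k ++ u
        ≡⟨ sym (pow-sucʳ u k) ⟩
      pow u (suc k) ∎
      where
      open ≡-Reasoning
      u = block 0 ++ reverse (block 0)

    take-odd : ∀ k → suc (k + k) ≤ B →
      take (suc (k + k) * d) xs ≡ pow (block 0 ++ reverse (block 0)) k ++ block 0
    take-odd k lt = trans (take-*-suc (k + k)) (cong₂ _++_ (take-even k (<⇒≤ lt)) (block-even k lt))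

module _ {A : Set} {n : ℕ} (S : Vec A n) where

  HasPal-mono : ∀ {m ℓ ℓ′} → ℓ′ ≤ ℓ → HasPal S m ℓ → HasPal S m ℓ′
  HasPal-mono ℓ′≤ℓ hp i 1≤i i≤ℓ′ = hp i 1≤i (≤-trans i≤ℓ′ ℓ′≤ℓ)

  HasPal-bounds : ∀ {m ℓ} → 0 < ℓ → HasPal S m ℓ → ℓ ≤ m × m + ℓ ≤ n
  HasPal-bounds 0<ℓ hp = let _ , ℓ≤m , mℓ≤n , _ = hp _ 0<ℓ ≤-refl in ℓ≤m , mℓ≤n

  HasPal⇒Palindromic : ∀ {m ℓ} → HasPal S m ℓ → Palindromic (charAt S) m ℓ
  HasPal⇒Palindromic {m} hp = palindromic-from-left λ x j x+j≡m j<ℓ →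
    let _ , _ , _ , same = hp (suc j) (s≤s z≤n) j<ℓ
    in trans (cong (charAt S) (sym (m∸j≡x x j x+j≡m))) same
    where
    m∸j≡x : ∀ x j → x + j ≡ m → m ∸ j ≡ x
    m∸j≡x x j refl = m+n∸n≡m x j

  Palindromic⇒HasPal : ∀ {m ℓ} → Palindromic (charAt S) m ℓ → ℓ ≤ m → m + ℓ ≤ n → HasPal S m ℓ
  Palindromic⇒HasPal {m} {ℓ} P ℓ≤m mℓ≤n i 1≤i i≤ℓ with m≤n⇒∃[o]m+o≡n (≤-trans i≤ℓ ℓ≤m)
  ... | k , refl = subst (1 ≤_) (sym left≡) (s≤s z≤n) , m≤m+n i k , ≤-trans right≤ mℓ≤n ,
    subst (λ x → charAt S x ≡ charAt S (i + k + i)) (sym left≡)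
      (mirror P (suc k) (i + k + i) (solve (i ∷ k ∷ [])) left≤ right≤)
    where
    left≡ : suc (i + k) ∸ i ≡ suc k
    left≡ = trans (cong (_∸ i) (sym (+-suc i k))) (m+n∸m≡n i (suc k))
    left≤ : suc k ≤ i + k + ℓ
    left≤ = ≤-trans (+-monoˡ-≤ k 1≤i) (m≤m+n (i + k) ℓ)
    right≤ : i + k + i ≤ i + k + ℓ
    right≤ = +-monoʳ-≤ (i + k) i≤ℓ

  take-drop-reverse : ∀ {m ℓ} → Palindromic (charAt S) m ℓ → ∀ p k → p ≤ ℓ → k + p ≡ m →
    take p (drop m (toList S)) ≡ reverse (take p (drop k (toList S)))
  take-drop-reverse P zero    k _   _  = refl
  take-drop-reverse {m} {ℓ} P (suc p) k p<ℓ kp≡m = begin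
    take (suc p) (drop m L)                              ≡⟨ take-sucʳ p (drop m L) ⟩
    take p (drop m L) ++ fromMaybe (nth (drop m L) p)    ≡⟨ cong₂ _++_ inner (cong fromMaybe outer) ⟩
    reverse (take p (drop (suc k) L)) ++ fromMaybe (nth L k)
      ≡⟨ cong (reverse (take p (drop (suc k) L)) ++_) (sym (reverse-fromMaybe (nth L k))) ⟩
    reverse (take p (drop (suc k) L)) ++ reverse (fromMaybe (nth L k))
      ≡⟨ sym (reverse-++ (fromMaybe (nth L k)) (take p (drop (suc k) L))) ⟩
    reverse (fromMaybe (nth L k) ++ take p (drop (suc k) L))
      ≡⟨ cong reverse (sym (take-suc-drop p k L)) ⟩
    reverse (take (suc p) (drop k L))                    ∎
    where
    open ≡-Reasoning
    L = toList S
    inner : take p (drop m L) ≡ reverse (take p (drop (suc k) L))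
    inner = take-drop-reverse P p (suc k) (<⇒≤ p<ℓ) (trans (sym (+-suc k p)) kp≡m)
    outer : nth (drop m L) p ≡ nth L k
    outer = begin
      nth (drop m L) p      ≡⟨ nth-drop m p L ⟩
      nth L (m + p)         ≡⟨ cong (λ y → nth L (y ∸ 1)) (sym (+-suc m p)) ⟩
      charAt S (m + suc p)  ≡⟨ sym (mirror P (suc k) (m + suc p) k+m≡ k≤ (+-monoʳ-≤ m p<ℓ)) ⟩
      charAt S (suc k)      ∎
      where
      k+m≡ : suc k + (m + suc p) ≡ suc (m + m)
      k+m≡ = begin
        suc k + (m + suc p)    ≡⟨ solve (k ∷ m ∷ p ∷ []) ⟩
        suc (m + (k + suc p))  ≡⟨ cong (λ z → suc (m + z)) kp≡m ⟩
        suc (m + m)            ∎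
      k≤ : suc k ≤ m + ℓ
      k≤ = ≤-trans (≤-by p (trans (sym (+-suc k p)) kp≡m)) (m≤m+n m ℓ)

module ConsecutiveCentres {A : Set} {n : ℕ} (S : Vec A n) (ℓ p : ℕ) (ms : ℕ → ℕ)
  (increasing : ∀ j → suc j < suc (suc p) → ms j < ms (suc j))
  (centre : ∀ j → j < suc (suc p) → IsPalMid S ℓ (ms j))
  (consecutive : ∀ q → ms 0 < q → q < ms (suc p) → IsPalMid S ℓ q → ∃ λ j → j < suc (suc p) × ms j ≡ q)
  (span : ms (suc p) ∸ ms 0 ≤ ℓ) where

  private
    h : ℕ
    h = suc (suc p)

  ms-< : ∀ {i j} → i < j → j < h → ms i < ms j
  ms-< {i} {suc j} i<j+1 j+1<h with m≤n⇒m<n∨m≡n (s≤s⁻¹ i<j+1)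
  ... | inj₁ i<j  = <-trans (ms-< i<j (<⇒≤ j+1<h)) (increasing j j+1<h)
  ... | inj₂ refl = increasing i j+1<h

  ms-≤ : ∀ {i j} → i ≤ j → j < h → ms i ≤ ms j
  ms-≤ i≤j j<h with m≤n⇒m<n∨m≡n i≤j
  ... | inj₁ i<j  = <⇒≤ (ms-< i<j j<h)
  ... | inj₂ refl = ≤-refl

  hasPal : ∀ j → j < h → HasPal S (ms j) ℓ
  hasPal j j<h = let _ , ℓ≤ℓ′ , hp = centre j j<h in HasPal-mono S ℓ≤ℓ′ hp

  palindromic : ∀ j → j < h → Palindromic (charAt S) (ms j) ℓ
  palindromic j j<h = HasPal⇒Palindromic S (hasPal j j<h)

  0<ℓ : 0 < ℓ
  0<ℓ = ≤-trans (m<n⇒0<n∸m (ms-< (s≤s z≤n) ≤-refl)) span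

  ℓ≤ms : ∀ j → j < h → ℓ ≤ ms j
  ℓ≤ms j j<h = proj₁ (HasPal-bounds S 0<ℓ (hasPal j j<h))

  ms+ℓ≤n : ∀ j → j < h → ms j + ℓ ≤ n
  ms+ℓ≤n j j<h = proj₂ (HasPal-bounds S 0<ℓ (hasPal j j<h))

  ms≤ms₀+ℓ : ∀ j → j < h → ms j ≤ ms 0 + ℓ
  ms≤ms₀+ℓ j j<h = ≤-trans (ms-≤ (s≤s⁻¹ j<h) ≤-refl)
    (≤-trans (m≤n+m∸n (ms (suc p)) (ms 0)) (+-monoʳ-≤ (ms 0) span))

  no-centre-between : ∀ k → suc k < h → NoPalindromeBetween (charAt S) ℓ (ms k) (ms (suc k))
  no-centre-between k k+1<h q k<q q<k+1 Pq
    with consecutive q ms₀<q q<last (ℓ , ≤-refl , Palindromic⇒HasPal S Pq ℓ≤q q+ℓ≤n)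
    where
    k<h : k < h
    k<h = <⇒≤ k+1<h
    ms₀<q : ms 0 < q
    ms₀<q = ≤-<-trans (ms-≤ z≤n k<h) k<q
    q<last : q < ms (suc p)
    q<last = <-≤-trans q<k+1 (ms-≤ (s≤s⁻¹ k+1<h) ≤-refl)
    ℓ≤q : ℓ ≤ q
    ℓ≤q = ≤-trans (ℓ≤ms k k<h) (<⇒≤ k<q)
    q+ℓ≤n : q + ℓ ≤ n
    q+ℓ≤n = ≤-trans (+-monoˡ-≤ ℓ (<⇒≤ q<k+1)) (ms+ℓ≤n (suc k) k+1<h)
  ... | j , j<h , refl with j ≤? k
  ...   | yes j≤k = <⇒≱ k<q (ms-≤ j≤k (<⇒≤ k+1<h))
  ...   | no j≰k  = <⇒≱ q<k+1 (ms-≤ (≰⇒> j≰k) j<h)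

  gap : ℕ → ℕ
  gap k = ms (suc k) ∸ ms k

  ms+gap : ∀ k → suc k < h → ms k + gap k ≡ ms (suc k)
  ms+gap k k+1<h = m+[n∸m]≡n (<⇒≤ (increasing k k+1<h))

  gap-suc : ∀ k → suc (suc k) < h → gap (suc k) ≡ gap k
  gap-suc k k+2<h = sym (palindromic-gaps-equal
    (palindromic k k<h) (palindromic (suc k) k+1<h) (palindromic (suc (suc k)) k+2<h)
    (ms+gap k k+1<h) (ms+gap (suc k) k+2<h)
    (m<n⇒0<n∸m (increasing k k+1<h)) (m<n⇒0<n∸m (increasing (suc k) k+2<h))
    (≤-trans (ms≤ms₀+ℓ (suc (suc k)) k+2<h) (+-monoˡ-≤ ℓ (ms-≤ z≤n k<h))) (ℓ≤ms k k<h)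
    (no-centre-between k k+1<h) (no-centre-between (suc k) k+2<h))
    where
    k+1<h : suc k < h
    k+1<h = <⇒≤ k+2<h
    k<h : k < h
    k<h = <⇒≤ k+1<h

  gap-equal : ∀ k → suc k < h → gap k ≡ gap 0
  gap-equal zero    _     = refl
  gap-equal (suc k) k+2<h = trans (gap-suc k k+2<h) (gap-equal k (<⇒≤ k+2<h))

  ms-linear : ∀ t → t < h → ms t ≡ ms 0 + t * gap 0
  ms-linear zero    _     = sym (+-identityʳ (ms 0))
  ms-linear (suc t) t+1<h = begin
    ms (suc t)                       ≡⟨ sym (ms+gap t t+1<h) ⟩
    ms t + gap t                     ≡⟨ cong₂ _+_ (ms-linear t (<⇒≤ t+1<h)) (gap-equal t t+1<h) ⟩
    ms 0 + t * gap 0 + gap 0         ≡⟨ +-assoc (ms 0) (t * gap 0) (gap 0) ⟩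
    ms 0 + (t * gap 0 + gap 0)       ≡⟨ cong (ms 0 +_) (+-comm (t * gap 0) (gap 0)) ⟩
    ms 0 + suc t * gap 0             ∎
    where open ≡-Reasoning

  private
    L : List A
    L = toList S

    xs : List A
    xs = drop (ms 0) L

    w : List A
    w = block xs (gap 0) 0

  block-at : ∀ t → t < h → block xs (gap 0) t ≡ take (gap 0) (drop (ms t) L)
  block-at t t<h = cong (take (gap 0))
    (trans (drop-drop (ms 0) (t * gap 0) L) (cong (λ m → drop m L) (sym (ms-linear t t<h))))

  blocks-mirrored : ∀ t → suc t < suc p → block xs (gap 0) (suc t) ≡ reverse (block xs (gap 0) t)
  blocks-mirrored t t+1<p+1 = begin
    block xs (gap 0) (suc t)                 ≡⟨ block-at (suc t) t+1<h ⟩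
    take (gap 0) (drop (ms (suc t)) L)       ≡⟨ take-drop-reverse S (palindromic (suc t) t+1<h) (gap 0) (ms t) gap≤ℓ
                                                  (trans (cong (ms t +_) (sym (gap-equal t t+1<h))) (ms+gap t t+1<h)) ⟩
    reverse (take (gap 0) (drop (ms t) L))   ≡⟨ cong reverse (sym (block-at t (<⇒≤ t+1<h))) ⟩
    reverse (block xs (gap 0) t)             ∎
    where
    open ≡-Reasoning
    t+1<h : suc t < h
    t+1<h = ≤-trans t+1<p+1 (n≤1+n _)
    gap≤ℓ : gap 0 ≤ ℓ
    gap≤ℓ = ≤-trans (∸-monoˡ-≤ (ms 0) (ms-≤ (s≤s z≤n) ≤-refl)) span

  slice-blocks : slice S (suc (ms 0)) (ms (suc p)) ≡ take (suc p * gap 0) xs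
  slice-blocks = cong (λ m → take m xs)
    (trans (cong (_∸ ms 0) (ms-linear (suc p) ≤-refl)) (m+n∸m≡n (ms 0) _))

  slice-odd : ∀ k → h ≡ 1 + 2 * k →
    slice S (suc (ms 0)) (ms (suc p)) ≡ pow (w ++ reverse w) k
  slice-odd k h≡ = trans slice-blocks (trans (cong (λ m → take (m * gap 0) xs) p+1≡k+k)
    (take-even xs (gap 0) blocks-mirrored k (≤-reflexive (sym p+1≡k+k))))
    where
    p+1≡k+k : suc p ≡ k + k
    p+1≡k+k = trans (suc-injective h≡) (solve (k ∷ []))

  slice-even : ∀ k → h ≡ 2 + 2 * k →
    slice S (suc (ms 0)) (ms (suc p)) ≡ pow (w ++ reverse w) k ++ w
  slice-even k h≡ = trans slice-blocks (trans (cong (λ m → take (m * gap 0) xs) p+1≡2k+1)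
    (take-odd xs (gap 0) blocks-mirrored k (≤-reflexive (sym p+1≡2k+1))))
    where
    p+1≡2k+1 : suc p ≡ suc (k + k)
    p+1≡2k+1 = trans (suc-injective h≡) (solve (k ∷ []))

lemma5 : {A : Set} {n : ℕ} (S : Vec A n) (ℓ* h : ℕ) (ms : ℕ → ℕ) →
    2 ≤ h →
    (∀ j → suc j < h → ms j < ms (suc j)) →
    (∀ j → j < h → 1 ≤ ms j × ms j ≤ n) →
    (∀ j → j < h → IsPalMid S ℓ* (ms j)) →
    (∀ p → ms 0 < p → p < ms (h ∸ 1) → IsPalMid S ℓ* p → ∃ λ j → j < h × ms j ≡ p) →
    ms (h ∸ 1) ∸ ms 0 ≤ ℓ* →
    (∀ k → suc k < h → ms (suc k) ∸ ms k ≡ ms 1 ∸ ms 0)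
    × (∀ k → h ≡ 1 + 2 * k →
         slice S (suc (ms 0)) (ms (h ∸ 1))
           ≡ pow (slice S (suc (ms 0)) (ms 1) ++ reverse (slice S (suc (ms 0)) (ms 1))) k)
    × (∀ k → h ≡ 2 + 2 * k →
         slice S (suc (ms 0)) (ms (h ∸ 1))
           ≡ pow (slice S (suc (ms 0)) (ms 1) ++ reverse (slice S (suc (ms 0)) (ms 1))) k
             ++ slice S (suc (ms 0)) (ms 1))
lemma5 S ℓ* (suc (suc p)) ms (s≤s (s≤s z≤n)) increasing _ centre consecutive span =
  gap-equal , slice-odd , slice-even
  where open ConsecutiveCentres S ℓ* p ms increasing centre consecutive span
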